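{- Let $M$ be a fixed deterministic Turing machine and let $D$, $F$, $B_T$ be as defined in the context. Let $(p_n)_{n \in \mathbb{N}}$ be defined by $p_0 = \bot$ (the everywhere-undefined function) and $p_{n+1} = F(p_n)$, and let $p_\omega = \bigsqcup_{n \in \mathbb{N}} p_n$. Then $F$ has a least fixed point and $\operatorname{lfp}(F) = \bigsqcup_{n\in\mathbb{N}} p_n = p_\omega$; moreover $p_\omega \notin \bigcup_{T \in \mathbb{N}} B_T$.
   Context: Let $D$ be the set of partial functions $p : \mathbb{N} \to \{0,1,\bot\}$ (where $p(k)=\bot$ means $p$ is undefined at $k$) satisfying: $p(k) = 1$ implies $p(k') = 1$ for all $k' \ge k$, ordered by $p \sqsubseteq q$ iff $q(x) = p(x)$ whenever $p(x) \neq \bot$; $\bigsqcup$ denotes least upper bound in this order and $\operatorname{lfp}(F)$ the least fixed point of $F$ with respect to $\sqsubseteq$. Define $F : D \to D$ by: $F(p)(0) = 1$ if $M$ halts at or before step $0$, and $F(p)(0) = 0$ otherwise; and for $k \ge 0$, $F(p)(k+1) = \bot$ if $p(k) = \bot$; $F(p)(k+1) = 1$ if $p(k) = 1$; $F(p)(k+1) = 1$ if $p(k) = 0$ and $M$ halts at exactly step $k+1$; $F(p)(k+1) = 0$ if $p(k) = 0$ and $M$ does not halt at step $k+1$. For $T \in \mathbb{N}$, $B_T$ denotes the class of finite halting observations computable by a machine with time bound $T$, namely the partial functions defined on $\{0, 1, \ldots, T-1\}$ and undefined ($=\bot$) at every $k \ge T$. -}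

module Defs where

open import Data.Nat using (ℕ; zero; suc; _≤_; _<_; _≥_)
open import Data.Bool using (Bool; true; false; _∨_; not; _∧_)
open import Data.Product using (Σ; _×_; _,_)
open import Relation.Binary.PropositionalEquality using (_≡_; _≢_)

-- A deterministic machine, abstracted as a deterministic transition system:
-- configurations, an initial configuration, a (deterministic) step function
-- and a decidable halting test on configurations.  Every deterministic
-- Turing machine yields such a record.
record Machine : Set₁ where
  field
    Config : Set
    init   : Config
    step   : Config → Config
    halted : Config → Bool

module _ (M : Machine) where
  open Machine M

  run : ℕ → Config
  run zero    = init
  run (suc k) = step (run k)

  haltingAt : ℕ → Bool
  haltingAt k = halted (run k)

  haltedBy : ℕ → Bool
  haltedBy zero    = haltingAt zero
  haltedBy (suc k) = haltedBy k ∨ haltingAt (suc k)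

  haltsBy0 : Bool
  haltsBy0 = haltedBy zero

  haltsExactlyAtSuc : ℕ → Bool
  haltsExactlyAtSuc k = not (haltedBy k) ∧ haltingAt (suc k)

data 𝟛 : Set where
  ⊥v 0v 1v : 𝟛

-- partial functions ℕ → {0,1} with ⊥ meaning "undefined"
PF : Set
PF = ℕ → 𝟛

InD : PF → Set
InD p = ∀ k k' → k ≤ k' → p k ≡ 1v → p k' ≢ ⊥v → p k' ≡ 1v

_⊑_ : PF → PF → Set
p ⊑ q = ∀ x → p x ≢ ⊥v → q x ≡ p x

_≈_ : PF → PF → Set
p ≈ q = ∀ x → p x ≡ q x

⊥PF : PF
⊥PF _ = ⊥v

F : Machine → PF → PF
F M p zero with haltsBy0 M
... | true  = 1v
... | false = 0v
F M p (suc k) with p k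
... | ⊥v = ⊥v
... | 1v = 1v
... | 0v with haltsExactlyAtSuc M k
...   | true  = 1v
...   | false = 0v

iter : Machine → ℕ → PF
iter M zero    = ⊥PF
iter M (suc n) = F M (iter M n)

IsLub : (ℕ → PF) → PF → Set
IsLub c q = InD q × (∀ n → c n ⊑ q) × (∀ r → InD r → (∀ n → c n ⊑ r) → q ⊑ r)

IsLfp : (PF → PF) → PF → Set
IsLfp G q = InD q × (G q ≈ q) × (∀ r → InD r → G r ≈ r → q ⊑ r)

InB : ℕ → PF → Set
InB T p = (∀ k → k < T → p k ≢ ⊥v) × (∀ k → k ≥ T → p k ≡ ⊥v)

-- F is a first-order recurrence: F p 0 is a fixed value and F p (k+1) depends only on p k.
-- Such an operator has exactly one fixed point, the sequence solving the recurrence,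
-- and its n-th Kleene iterate is that sequence cut off at n, since the step map sends ⊥ to ⊥.
-- The solution is therefore the limit of the iterates; it is total because neither the
-- initial value nor the step map produces ⊥ from a defined value, so it lies in no B_T.
module Submission where

open import Defs
open import Data.Nat using (ℕ; zero; suc; _≤_; _<_; _≤′_; ≤′-refl; ≤′-step; s≤s)
open import Data.Nat.Properties using (≤-refl; _<?_; ≮⇒≥; ≤⇒≤′)
open import Data.Bool using (Bool; true; false)
open import Data.Product using (Σ; _×_; _,_)
open import Data.Empty using (⊥-elim)
open import Relation.Nullary using (¬_; yes; no)
open import Relation.Binary.PropositionalEquality
  using (_≡_; _≢_; refl; sym; trans; cong; subst; module ≡-Reasoning)

≈⇒⊑ : ∀ {p q} → p ≈ q → p ⊑ q
≈⇒⊑ p≈q x _ = sym (p≈q x)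

IsLub-cong : ∀ {c d q} → (∀ n → c n ≡ d n) → IsLub c q → IsLub d q
IsLub-cong {q = q} c≡d (q∈D , upper , least) =
    q∈D
  , (λ n → subst (_⊑ q) (c≡d n) (upper n))
  , (λ r r∈D d⊑r → least r r∈D (λ n → subst (_⊑ r) (sym (c≡d n)) (d⊑r n)))

total⇒∉B : ∀ {p} → (∀ k → p k ≢ ⊥v) → ¬ Σ ℕ (λ T → InB T p)
total⇒∉B total (T , _ , undefined-from-T) = total T (undefined-from-T T ≤-refl)

module FirstOrderRecurrence
  (G : PF → PF) (a : 𝟛) (f : ℕ → 𝟛 → 𝟛)
  (G-zero : ∀ p → G p zero ≡ a)
  (G-suc : ∀ p k → G p (suc k) ≡ f k (p k))
  where

  solution : PF
  solution zero    = a
  solution (suc k) = f k (solution k)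

  kleene : ℕ → PF
  kleene zero    = ⊥PF
  kleene (suc n) = G (kleene n)

  solution-fixed : G solution ≈ solution
  solution-fixed zero    = G-zero solution
  solution-fixed (suc k) = G-suc solution k

  fixed⇒≈solution : ∀ r → G r ≈ r → r ≈ solution
  fixed⇒≈solution r fixed zero = trans (sym (fixed zero)) (G-zero r)
  fixed⇒≈solution r fixed (suc k) = begin
    r (suc k)          ≡⟨ sym (fixed (suc k)) ⟩
    G r (suc k)        ≡⟨ G-suc r k ⟩
    f k (r k)          ≡⟨ cong (f k) (fixed⇒≈solution r fixed k) ⟩
    f k (solution k)   ∎
    where open ≡-Reasoning

  solution-lfp : InD solution → IsLfp G solution
  solution-lfp solution∈D =
      solution∈D
    , solution-fixed
    , (λ r _ fixed → ≈⇒⊑ (λ x → sym (fixed⇒≈solution r fixed x)))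

  kleene-below : ∀ {n k} → k < n → kleene n k ≡ solution k
  kleene-below {suc n} {zero}  _         = G-zero (kleene n)
  kleene-below {suc n} {suc k} (s≤s k<n) =
    trans (G-suc (kleene n) k) (cong (f k) (kleene-below k<n))

  solution-⊑-upperBound : ∀ r → (∀ n → kleene n ⊑ r) → solution ⊑ r
  solution-⊑-upperBound r upper k defined =
    trans (upper (suc k) k (λ e → defined (trans (sym below) e))) below
    where
    below : kleene (suc k) k ≡ solution k
    below = kleene-below ≤-refl

  module _ (f-strict : ∀ k → f k ⊥v ≡ ⊥v) where

    kleene-above : ∀ {n k} → n ≤ k → kleene n k ≡ ⊥v
    kleene-above {zero}          _         = refl
    kleene-above {suc n} {suc k} (s≤s n≤k) =
      trans (G-suc (kleene n) k) (trans (cong (f k) (kleene-above n≤k)) (f-strict k))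

    kleene⊑solution : ∀ n → kleene n ⊑ solution
    kleene⊑solution n k defined with k <? n
    ... | yes k<n = sym (kleene-below k<n)
    ... | no  k≮n = ⊥-elim (defined (kleene-above (≮⇒≥ k≮n)))

    solution-lub : InD solution → IsLub kleene solution
    solution-lub solution∈D =
      solution∈D , kleene⊑solution , (λ r _ → solution-⊑-upperBound r)

  module _ (f-absorbing : ∀ k → f k 1v ≡ 1v) where

    one-persists : ∀ {k k'} → k ≤′ k' → solution k ≡ 1v → solution k' ≡ 1v
    one-persists ≤′-refl              one = one
    one-persists (≤′-step {k'} k≤′k') one =
      trans (cong (f k') (one-persists k≤′k' one)) (f-absorbing k')

    solution∈D : InD solution
    solution∈D k k' k≤k' one _ = one-persists (≤⇒≤′ k≤k') one

  solution-total : a ≢ ⊥v → (∀ k v → v ≢ ⊥v → f k v ≢ ⊥v) → ∀ k → solution k ≢ ⊥v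
  solution-total a-defined _         zero    = a-defined
  solution-total a-defined f-defined (suc k) =
    f-defined k (solution k) (solution-total a-defined f-defined k)

bit : Bool → 𝟛
bit true  = 1v
bit false = 0v

bit-defined : ∀ b → bit b ≢ ⊥v
bit-defined true  ()
bit-defined false ()

module HaltingRecurrence (M : Machine) where

  initial : 𝟛
  initial = bit (haltsBy0 M)

  next : ℕ → 𝟛 → 𝟛
  next k ⊥v = ⊥v
  next k 0v = bit (haltsExactlyAtSuc M k)
  next k 1v = 1v

  F-zero : ∀ p → F M p zero ≡ initial
  F-zero p with haltsBy0 M
  ... | true  = refl
  ... | false = refl

  F-suc : ∀ p k → F M p (suc k) ≡ next k (p k)
  F-suc p k with p k
  ... | ⊥v = refl
  ... | 1v = refl
  ... | 0v with haltsExactlyAtSuc M k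
  ...   | true  = refl
  ...   | false = refl

  next-defined : ∀ k v → v ≢ ⊥v → next k v ≢ ⊥v
  next-defined k ⊥v undefined = ⊥-elim (undefined refl)
  next-defined k 0v _         = bit-defined (haltsExactlyAtSuc M k)
  next-defined k 1v _         = λ ()

  open FirstOrderRecurrence (F M) initial next F-zero F-suc public

  iter≡kleene : ∀ n → iter M n ≡ kleene n
  iter≡kleene zero    = refl
  iter≡kleene (suc n) = cong (F M) (iter≡kleene n)

mainTheorem4 : (M : Machine) →
    Σ PF (λ pω → IsLub (iter M) pω × IsLfp (F M) pω × ¬ (Σ ℕ (λ T → InB T pω)))
mainTheorem4 M =
    solution
  , IsLub-cong (λ n → sym (iter≡kleene n)) (solution-lub (λ _ → refl) p∈D)
  , solution-lfp p∈D
  , total⇒∉B (solution-total (bit-defined (haltsBy0 M)) next-defined)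
  where
  open HaltingRecurrence M
  p∈D : InD solution
  p∈D = solution∈D (λ _ → refl)
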